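{- Let $n$ be a positive integer. For $k \ge 0$, let \[ C_k = \sum_{j=0}^{n-1} \frac{n^j}{j!} + \frac{n^{n-1}}{(n-1)!}\left(1+n+\mathop{\mathrm{K}}_{m=1}^{k}\left(\frac{ -n(m+n-1)}{m+2n+1}\right)\right) \] be the $k$-th convergent of the continued fraction expansion of $e^n$, where the empty continued fraction ($k=0$) is $0$. Then, as $k\to\infty$ with $n$ fixed, \[ \left| e^n - C_k \right| = O\left(\frac{n^{k+1}}{(k+1)(k+2)\,(n)_{k+2}}\right). \]
   Context: $(a)_0=1$ and $(a)_k=a(a+1)\cdots(a+k-1)$ is the Pochhammer symbol. The finite continued fraction $\mathop{\mathrm{K}}_{m=1}^{k}\left(\frac{a_m}{b_m}\right)$ denotes \[ \cfrac{a_1}{b_1+\cfrac{a_2}{\ddots+\cfrac{a_k}{b_k}}}. \] -}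

module Defs where

open import Data.Nat as ℕ using (ℕ; zero; suc)
open import Data.Nat.Base using (_!)
open import Data.Nat.Properties using (_≟_)
open import Data.Integer as ℤ using (+_)
open import Data.Rational using (ℚ; 0ℚ; 1ℚ; _+_; _-_; _*_; -_; _÷_; _≤_; _<_; ∣_∣; mkℚ; NonZero)
open import Relation.Nullary using (yes; no)
open import Relation.Binary.PropositionalEquality using (_≡_)
import Data.Rational.Properties as ℚP

ℕ→ℚ : ℕ → ℚ
ℕ→ℚ m = (+ m) Data.Rational./ 1

-- total division on ℚ: p ⊘ q = p / q when q ≠ 0, and 0 when q = 0
-- (convention only; used for the continued fraction)
_⊘_ : ℚ → ℚ → ℚ
p ⊘ q with ℚP._≟_ q 0ℚ
... | yes _ = 0ℚ
... | no q≢0 = _÷_ p q {{Data.Rational.≢-nonZero q≢0}}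

_/ℕ_ : ℕ → ℕ → ℚ
p /ℕ q = ℕ→ℚ p ⊘ ℕ→ℚ q

poch : ℕ → ℕ → ℕ
poch a zero = 1
poch a (suc k) = poch a k ℕ.* (a ℕ.+ k)

Σ< : ℕ → (ℕ → ℚ) → ℚ
Σ< zero f = 0ℚ
Σ< (suc N) f = Σ< N f + f N

cfFrom : (ℕ → ℚ) → (ℕ → ℚ) → ℕ → ℕ → ℚ
cfFrom a b zero s = 0ℚ
cfFrom a b (suc r) s = a s ⊘ (b s + cfFrom a b r (suc s))

K : (ℕ → ℚ) → (ℕ → ℚ) → ℕ → ℚ
K a b k = cfFrom a b k 1

cfNum : ℕ → ℕ → ℚ
cfNum n m = - ℕ→ℚ (n ℕ.* (m ℕ.+ n ℕ.∸ 1))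

cfDen : ℕ → ℕ → ℚ
cfDen n m = ℕ→ℚ (m ℕ.+ 2 ℕ.* n ℕ.+ 1)

expPartial : ℕ → ℕ → ℚ
expPartial n N = Σ< N (λ j → (n ℕ.^ j) /ℕ (j !))

convergent : ℕ → ℕ → ℚ
convergent n k =
  expPartial n n
  + ((n ℕ.^ (n ℕ.∸ 1)) /ℕ ((n ℕ.∸ 1) !)) * (1ℚ + ℕ→ℚ n + K (cfNum n) (cfDen n) k)

errBound : ℕ → ℕ → ℚ
errBound n k = (n ℕ.^ suc k) /ℕ (suc k ℕ.* suc (suc k) ℕ.* poch n (suc (suc k)))

-- Notation: c = nᵐ/m!, (n+1)ₖ the rising factorial, and
--   Q_k = (k+1)(n+1)ₖ,   τⱼ = nʲ⁺¹/(j(j+1)(n+1)ⱼ),   D_k = τ₁ + … + τ_k,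
--   hᵢ = nⁱ/(n+1)ᵢ,      e_M = nᴹ⁺¹/((M+1)(n+1)_M).
-- (1) Continued fractions: numerators and denominators solving the three-term
--     recurrence give the convergents (with an arbitrary admissible tail), and
--     Euler's transformation turns the series Σ τ into such numerators.  For
--     eⁿ this shows K_{m=1}^{k} = -D_k, so C_k = Σ_{j<n} nʲ/j! + c(1 + n - D_k).
-- (2) Taylor side: Σ_{j<n+M+1} nʲ/j! = Σ_{j<n} nʲ/j! + c(h₀ + … + h_M), and the
--     telescoping identity h₀ + … + h_M + D_M + e_M = 1 + n gives
--     partial sum - C_k = -c((D_M - D_k) + e_M).
-- (3) Estimates: for k ≥ n the τⱼ at least halve, so D_M - D_k ≤ 2τ_{k+1},
--     and c·2τ_{k+1} = 2n²c · errBound n k; while c·e_M ≤ ε once M is large.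
module Submission where

open import Defs
open import Data.Nat using (ℕ; _≥_)
open import Data.Rational using (ℚ; 0ℚ; _+_; _-_; _*_; _≤_; _<_; ∣_∣)
open import Data.Product using (Σ; _×_)

open import Data.Nat as ℕ using (zero; suc; _!; NonZero)
import Data.Nat.Properties as ℕP
open ℕP using (_!≢0)
import Data.Nat.Tactic.RingSolver as ℕRing
import Data.Nat.Coprimality as Coprime
open import Data.Integer as ℤ using (+_)
import Data.Integer.Properties as ℤP
open import Data.Rational as Q using (1ℚ; -_; mkℚ; 1/_)
import Data.Rational.Properties as QP
import Data.Rational.Unnormalised as U
import Data.Rational.Unnormalised.Properties as UP
import Data.Rational.Solver
import Algebra.Properties.Group as GroupProperties
open import Data.Product using (_,_)
open import Data.Empty using (⊥-elim)
open import Relation.Nullary using (yes; no)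
open import Relation.Binary.PropositionalEquality

module QS = Data.Rational.Solver.+-*-Solver

-- The embedding of ℕ into ℚ is the canonical fraction k/1; it is an ordered
-- semiring homomorphism, which lets us move identities and inequalities
-- between ℕ (where the ring solver is cheap) and ℚ.

ℕ→ℚ-mkℚ : ∀ k → ℕ→ℚ k ≡ mkℚ (+ k) 0 (Coprime.sym (Coprime.1-coprimeTo k))
ℕ→ℚ-mkℚ k = QP.↥p/↧p≡p (mkℚ (+ k) 0 (Coprime.sym (Coprime.1-coprimeTo k)))

ℕ→ℚ-+ : ∀ x y → ℕ→ℚ (x ℕ.+ y) ≡ ℕ→ℚ x + ℕ→ℚ y
ℕ→ℚ-+ x y rewrite ℕ→ℚ-mkℚ x | ℕ→ℚ-mkℚ y =
  QP./-cong {p₂ = + x ℤ.* + 1 ℤ.+ + y ℤ.* + 1} {q₂ = 1}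
    (trans (ℤP.pos-+ x y) (sym (cong₂ ℤ._+_ (ℤP.*-identityʳ (+ x)) (ℤP.*-identityʳ (+ y)))))
    refl

ℕ→ℚ-* : ∀ x y → ℕ→ℚ (x ℕ.* y) ≡ ℕ→ℚ x * ℕ→ℚ y
ℕ→ℚ-* x y rewrite ℕ→ℚ-mkℚ x | ℕ→ℚ-mkℚ y =
  QP./-cong {p₂ = + x ℤ.* + y} {q₂ = 1} (ℤP.pos-* x y) refl

ℕ→ℚ-mono-≤ : ∀ {x y} → x ℕ.≤ y → ℕ→ℚ x ≤ ℕ→ℚ y
ℕ→ℚ-mono-≤ {x} {y} x≤y rewrite ℕ→ℚ-mkℚ x | ℕ→ℚ-mkℚ y =
  Q.*≤* (subst₂ ℤ._≤_ (sym (ℤP.*-identityʳ (+ x))) (sym (ℤP.*-identityʳ (+ y))) (ℤ.+≤+ x≤y))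

ℕ→ℚ-nonNeg : ∀ x → 0ℚ ≤ ℕ→ℚ x
ℕ→ℚ-nonNeg x = ℕ→ℚ-mono-≤ {0} {x} ℕ.z≤n

ℕ→ℚ-positive : ∀ y → NonZero y → Q.Positive (ℕ→ℚ y)
ℕ→ℚ-positive zero nz = ⊥-elim (ℕ.≢-nonZero⁻¹ 0 {{nz}} refl)
ℕ→ℚ-positive (suc y) _ rewrite ℕ→ℚ-mkℚ (suc y) = _

ℕ→ℚ-≢0 : ∀ y → NonZero y → ℕ→ℚ y ≢ 0ℚ
ℕ→ℚ-≢0 y nz eq = QP.<⇒≢ (QP.positive⁻¹ (ℕ→ℚ y) {{ℕ→ℚ-positive y nz}}) (sym eq)

ℕ→ℚ-rearrange : ∀ x y z A B → x ℕ.+ A ℕ.* z ≡ B ℕ.* y →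
                ℕ→ℚ x ≡ ℕ→ℚ B * ℕ→ℚ y + - ℕ→ℚ A * ℕ→ℚ z
ℕ→ℚ-rearrange x y z A B eq = begin
    ℕ→ℚ x                                        ≡⟨ QS.solve 2 (λ X W → X QS.:= (X QS.:+ W) QS.:+ QS.:- W) refl (ℕ→ℚ x) (ℕ→ℚ (A ℕ.* z)) ⟩
    (ℕ→ℚ x + ℕ→ℚ (A ℕ.* z)) + - ℕ→ℚ (A ℕ.* z)   ≡⟨ cong₂ (λ s t → s + - t) (sym (ℕ→ℚ-+ x (A ℕ.* z))) (ℕ→ℚ-* A z) ⟩
    ℕ→ℚ (x ℕ.+ A ℕ.* z) + - (ℕ→ℚ A * ℕ→ℚ z)     ≡⟨ cong₂ _+_ (trans (cong ℕ→ℚ eq) (ℕ→ℚ-* B y)) (QP.neg-distribˡ-* (ℕ→ℚ A) (ℕ→ℚ z)) ⟩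
    ℕ→ℚ B * ℕ→ℚ y + - ℕ→ℚ A * ℕ→ℚ z ∎
  where open ≡-Reasoning

neg-involutive : ∀ p → - (- p) ≡ p
neg-involutive = GroupProperties.⁻¹-involutive QP.+-0-group

⊘-inverse : ∀ x y → y ≢ 0ℚ → (x ⊘ y) * y ≡ x
⊘-inverse x y y≢0 with QP._≟_ y 0ℚ
... | yes y≡0 = ⊥-elim (y≢0 y≡0)
... | no y≢0′ =
  let instance _ = Q.≢-nonZero y≢0′ in
  trans (QP.*-assoc x (1/ y) y) (trans (cong (x *_) (QP.*-inverseˡ y)) (QP.*-identityʳ x))

*-cancelʳ-≢0 : ∀ a b c → c ≢ 0ℚ → a * c ≡ b * c → a ≡ b
*-cancelʳ-≢0 a b c c≢0 eq =
  let instance _ = Q.≢-nonZero c≢0 in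
  begin
    a                ≡⟨ sym (QP.*-identityʳ a) ⟩
    a * 1ℚ           ≡⟨ cong (a *_) (sym (QP.*-inverseʳ c)) ⟩
    a * (c * 1/ c)   ≡⟨ sym (QP.*-assoc a c (1/ c)) ⟩
    (a * c) * 1/ c   ≡⟨ cong (_* 1/ c) eq ⟩
    (b * c) * 1/ c   ≡⟨ QP.*-assoc b c (1/ c) ⟩
    b * (c * 1/ c)   ≡⟨ cong (b *_) (QP.*-inverseʳ c) ⟩
    b * 1ℚ           ≡⟨ QP.*-identityʳ b ⟩
    b ∎
  where open ≡-Reasoning

/ℕ-inverse : ∀ x y → NonZero y → (x /ℕ y) * ℕ→ℚ y ≡ ℕ→ℚ x
/ℕ-inverse x y nz = ⊘-inverse (ℕ→ℚ x) (ℕ→ℚ y) (ℕ→ℚ-≢0 y nz)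

/ℕ-unique : ∀ {A} x y → NonZero y → A * ℕ→ℚ y ≡ ℕ→ℚ x → A ≡ x /ℕ y
/ℕ-unique {A} x y nz eq =
  *-cancelʳ-≢0 A (x /ℕ y) (ℕ→ℚ y) (ℕ→ℚ-≢0 y nz) (trans eq (sym (/ℕ-inverse x y nz)))

/ℕ-scale : ∀ x y w → NonZero y → (x /ℕ y) * ℕ→ℚ w ≡ (x ℕ.* w) /ℕ y
/ℕ-scale x y w nz = /ℕ-unique (x ℕ.* w) y nz (begin
    (x /ℕ y) * ℕ→ℚ w * ℕ→ℚ y     ≡⟨ QS.solve 3 (λ u W Y → u QS.:* W QS.:* Y QS.:= u QS.:* Y QS.:* W) refl (x /ℕ y) (ℕ→ℚ w) (ℕ→ℚ y) ⟩
    (x /ℕ y) * ℕ→ℚ y * ℕ→ℚ w     ≡⟨ cong (_* ℕ→ℚ w) (/ℕ-inverse x y nz) ⟩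
    ℕ→ℚ x * ℕ→ℚ w                ≡⟨ sym (ℕ→ℚ-* x w) ⟩
    ℕ→ℚ (x ℕ.* w) ∎)
  where open ≡-Reasoning

/ℕ-clear : ∀ x y w v → NonZero y → x ℕ.* w ≡ v ℕ.* y → (x /ℕ y) * ℕ→ℚ w ≡ ℕ→ℚ v
/ℕ-clear x y w v nz eq = trans (/ℕ-scale x y w nz)
  (sym (/ℕ-unique (x ℕ.* w) y nz (trans (sym (ℕ→ℚ-* v y)) (cong ℕ→ℚ (sym eq)))))

/ℕ-cross : ∀ x y x′ y′ → NonZero y → NonZero y′ →
           x ℕ.* y′ ≡ x′ ℕ.* y → x /ℕ y ≡ x′ /ℕ y′
/ℕ-cross x y x′ y′ nz nz′ eq = /ℕ-unique x′ y′ nz′ (/ℕ-clear x y y′ x′ nz eq)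

/ℕ-* : ∀ x y x′ y′ → NonZero y → NonZero y′ →
       (x /ℕ y) * (x′ /ℕ y′) ≡ (x ℕ.* x′) /ℕ (y ℕ.* y′)
/ℕ-* x y x′ y′ nz nz′ = /ℕ-unique (x ℕ.* x′) (y ℕ.* y′) (ℕP.m*n≢0 y y′ {{nz}} {{nz′}}) (begin
    u * u′ * ℕ→ℚ (y ℕ.* y′)          ≡⟨ cong (u * u′ *_) (ℕ→ℚ-* y y′) ⟩
    u * u′ * (ℕ→ℚ y * ℕ→ℚ y′)        ≡⟨ QS.solve 4 (λ u u′ Y Y′ → u QS.:* u′ QS.:* (Y QS.:* Y′) QS.:= (u QS.:* Y) QS.:* (u′ QS.:* Y′)) refl u u′ (ℕ→ℚ y) (ℕ→ℚ y′) ⟩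
    (u * ℕ→ℚ y) * (u′ * ℕ→ℚ y′)      ≡⟨ cong₂ _*_ (/ℕ-inverse x y nz) (/ℕ-inverse x′ y′ nz′) ⟩
    ℕ→ℚ x * ℕ→ℚ x′                   ≡⟨ sym (ℕ→ℚ-* x x′) ⟩
    ℕ→ℚ (x ℕ.* x′) ∎)
  where
  open ≡-Reasoning
  u = x /ℕ y
  u′ = x′ /ℕ y′

/ℕ-+ : ∀ x y x′ y′ → NonZero y → NonZero y′ →
       (x /ℕ y) + (x′ /ℕ y′) ≡ (x ℕ.* y′ ℕ.+ x′ ℕ.* y) /ℕ (y ℕ.* y′)
/ℕ-+ x y x′ y′ nz nz′ = /ℕ-unique (x ℕ.* y′ ℕ.+ x′ ℕ.* y) (y ℕ.* y′) (ℕP.m*n≢0 y y′ {{nz}} {{nz′}}) (begin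
    (u + u′) * ℕ→ℚ (y ℕ.* y′)                      ≡⟨ cong ((u + u′) *_) (ℕ→ℚ-* y y′) ⟩
    (u + u′) * (ℕ→ℚ y * ℕ→ℚ y′)                    ≡⟨ QS.solve 4 (λ u u′ Y Y′ → (u QS.:+ u′) QS.:* (Y QS.:* Y′) QS.:= (u QS.:* Y) QS.:* Y′ QS.:+ (u′ QS.:* Y′) QS.:* Y) refl u u′ (ℕ→ℚ y) (ℕ→ℚ y′) ⟩
    (u * ℕ→ℚ y) * ℕ→ℚ y′ + (u′ * ℕ→ℚ y′) * ℕ→ℚ y  ≡⟨ cong₂ (λ s t → s * ℕ→ℚ y′ + t * ℕ→ℚ y) (/ℕ-inverse x y nz) (/ℕ-inverse x′ y′ nz′) ⟩
    ℕ→ℚ x * ℕ→ℚ y′ + ℕ→ℚ x′ * ℕ→ℚ y              ≡⟨ sym (cong₂ _+_ (ℕ→ℚ-* x y′) (ℕ→ℚ-* x′ y)) ⟩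
    ℕ→ℚ (x ℕ.* y′) + ℕ→ℚ (x′ ℕ.* y)              ≡⟨ sym (ℕ→ℚ-+ (x ℕ.* y′) (x′ ℕ.* y)) ⟩
    ℕ→ℚ (x ℕ.* y′ ℕ.+ x′ ℕ.* y) ∎)
  where
  open ≡-Reasoning
  u = x /ℕ y
  u′ = x′ /ℕ y′

/ℕ-double : ∀ x y → NonZero y → (x /ℕ y) + (x /ℕ y) ≡ (x ℕ.+ x) /ℕ y
/ℕ-double x y nz = trans (/ℕ-+ x y x y nz nz)
  (/ℕ-cross (x ℕ.* y ℕ.+ x ℕ.* y) (y ℕ.* y) (x ℕ.+ x) y (ℕP.m*n≢0 y y {{nz}} {{nz}}) nz (identity x y))
  where
  identity : ∀ x y → (x ℕ.* y ℕ.+ x ℕ.* y) ℕ.* y ≡ (x ℕ.+ x) ℕ.* (y ℕ.* y)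
  identity = ℕRing.solve-∀

/ℕ-nonNeg : ∀ x y → NonZero y → 0ℚ ≤ x /ℕ y
/ℕ-nonNeg x y nz = QP.*-cancelʳ-≤-pos (ℕ→ℚ y) {{ℕ→ℚ-positive y nz}} (begin
    0ℚ * ℕ→ℚ y        ≡⟨ QP.*-zeroˡ (ℕ→ℚ y) ⟩
    0ℚ                ≤⟨ ℕ→ℚ-nonNeg x ⟩
    ℕ→ℚ x             ≡⟨ sym (/ℕ-inverse x y nz) ⟩
    (x /ℕ y) * ℕ→ℚ y ∎)
  where open QP.≤-Reasoning

/ℕ-mono-≤ : ∀ x y x′ y′ → NonZero y → NonZero y′ →
            x ℕ.* y′ ℕ.≤ x′ ℕ.* y → x /ℕ y ≤ x′ /ℕ y′
/ℕ-mono-≤ x y x′ y′ nz nz′ le =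
  QP.*-cancelʳ-≤-pos (ℕ→ℚ (y ℕ.* y′)) {{ℕ→ℚ-positive _ (ℕP.m*n≢0 y y′ {{nz}} {{nz′}})}} (begin
    (x /ℕ y) * ℕ→ℚ (y ℕ.* y′)      ≡⟨ /ℕ-clear x y (y ℕ.* y′) (x ℕ.* y′) nz (swap x y y′) ⟩
    ℕ→ℚ (x ℕ.* y′)                 ≤⟨ ℕ→ℚ-mono-≤ le ⟩
    ℕ→ℚ (x′ ℕ.* y)                 ≡⟨ sym (/ℕ-clear x′ y′ (y ℕ.* y′) (x′ ℕ.* y) nz′ (trans (cong (x′ ℕ.*_) (ℕP.*-comm y y′)) (swap x′ y′ y))) ⟩
    (x′ /ℕ y′) * ℕ→ℚ (y ℕ.* y′) ∎)
  where
  open QP.≤-Reasoning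
  swap : ∀ a b c → a ℕ.* (b ℕ.* c) ≡ a ℕ.* c ℕ.* b
  swap = ℕRing.solve-∀

positive-fraction : ∀ ε → 0ℚ < ε → Σ ℕ λ d → Σ ℕ λ p → ε ≡ suc p /ℕ suc d
positive-fraction ε@(mkℚ (+ suc p) d _) _ = d , p , /ℕ-unique (suc p) (suc d) _ clear
  where
  clear : ε * ℕ→ℚ (suc d) ≡ ℕ→ℚ (suc p)
  clear rewrite ℕ→ℚ-mkℚ (suc d) | ℕ→ℚ-mkℚ (suc p) =
    QP.toℚᵘ-injective (UP.≃-trans (QP.toℚᵘ-homo-* ε (mkℚ (+ suc d) 0 (Coprime.sym (Coprime.1-coprimeTo (suc d)))))
      (U.*≡* (trans (ℤP.*-identityʳ _) (cong (λ w → + suc p ℤ.* + w) (sym (ℕP.*-identityʳ (suc d)))))))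
positive-fraction (mkℚ (+ zero) d _) (Q.*<* (ℤ.+<+ ()))
positive-fraction (mkℚ ℤ.-[1+ p ] d _) (Q.*<* ())

poch-nonZero : ∀ a k → NonZero (poch (suc a) k)
poch-nonZero a zero = _
poch-nonZero a (suc k) = ℕP.m*n≢0 (poch (suc a) k) (suc a ℕ.+ k) {{poch-nonZero a k}}

factorial-split : ∀ A i → (A ℕ.+ i) ! ≡ A ! ℕ.* poch (suc A) i
factorial-split A zero rewrite ℕP.+-identityʳ A = sym (ℕP.*-identityʳ (A !))
factorial-split A (suc i) rewrite ℕP.+-suc A i | factorial-split A i = identity A i (A !) (poch (suc A) i)
  where
  identity : ∀ A i F R → suc (A ℕ.+ i) ℕ.* (F ℕ.* R) ≡ F ℕ.* (R ℕ.* (suc A ℕ.+ i))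
  identity = ℕRing.solve-∀

poch-shift : ∀ a i → poch a (suc i) ≡ a ℕ.* poch (suc a) i
poch-shift a zero = identity a
  where
  identity : ∀ a → 1 ℕ.* (a ℕ.+ 0) ≡ a ℕ.* 1
  identity = ℕRing.solve-∀
poch-shift a (suc i) = trans (cong (ℕ._* (a ℕ.+ suc i)) (poch-shift a i)) (identity a i (poch (suc a) i))
  where
  identity : ∀ a i R → a ℕ.* R ℕ.* (a ℕ.+ suc i) ≡ a ℕ.* (R ℕ.* (suc a ℕ.+ i))
  identity = ℕRing.solve-∀

power≤poch : ∀ a M → a ℕ.^ M ℕ.≤ poch (suc a) M
power≤poch a zero = ℕP.≤-refl
power≤poch a (suc M) = ℕP.≤-trans
  (ℕP.*-mono-≤ (ℕP.≤-trans (ℕP.n≤1+n a) (ℕP.m≤m+n (suc a) M)) (power≤poch a M))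
  (ℕP.≤-reflexive (ℕP.*-comm (suc a ℕ.+ M) (poch (suc a) M)))

-- The arithmetic behind the halving of the series terms of eⁿ:
-- 2NJ ≤ J(N+J) ≤ (J+2)(N+J+1) for N ≤ J.
halving-inequality : ∀ N J → N ℕ.≤ J → 2 ℕ.* N ℕ.* J ℕ.≤ (2 ℕ.+ J) ℕ.* (suc N ℕ.+ J)
halving-inequality N J N≤J = begin
    2 ℕ.* N ℕ.* J        ≡⟨ double N J ⟩
    J ℕ.* N ℕ.+ J ℕ.* N  ≤⟨ ℕP.+-monoʳ-≤ (J ℕ.* N) (ℕP.*-monoʳ-≤ J N≤J) ⟩
    J ℕ.* N ℕ.+ J ℕ.* J  ≡⟨ sym (ℕP.*-distribˡ-+ J N J) ⟩
    J ℕ.* (N ℕ.+ J)      ≤⟨ ℕP.*-mono-≤ (ℕP.m≤n+m J 2) (ℕP.n≤1+n (N ℕ.+ J)) ⟩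
    (2 ℕ.+ J) ℕ.* (suc N ℕ.+ J) ∎
  where
  open ℕP.≤-Reasoning
  double : ∀ N J → 2 ℕ.* N ℕ.* J ≡ J ℕ.* N ℕ.+ J ℕ.* N
  double = ℕRing.solve-∀

Σ<-split : ∀ k δ f → Σ< (k ℕ.+ δ) f ≡ Σ< k f + Σ< δ (λ j → f (k ℕ.+ j))
Σ<-split k zero f = trans (cong (λ N → Σ< N f) (ℕP.+-identityʳ k)) (sym (QP.+-identityʳ (Σ< k f)))
Σ<-split k (suc δ) f = begin
    Σ< (k ℕ.+ suc δ) f                                        ≡⟨ cong (λ N → Σ< N f) (ℕP.+-suc k δ) ⟩
    Σ< (k ℕ.+ δ) f + f (k ℕ.+ δ)                              ≡⟨ cong (_+ f (k ℕ.+ δ)) (Σ<-split k δ f) ⟩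
    Σ< k f + Σ< δ (λ j → f (k ℕ.+ j)) + f (k ℕ.+ δ)           ≡⟨ QP.+-assoc (Σ< k f) _ _ ⟩
    Σ< k f + (Σ< δ (λ j → f (k ℕ.+ j)) + f (k ℕ.+ δ)) ∎
  where open ≡-Reasoning

Σ<-nonNeg : ∀ δ f → (∀ j → 0ℚ ≤ f j) → 0ℚ ≤ Σ< δ f
Σ<-nonNeg zero f f≥0 = QP.≤-refl
Σ<-nonNeg (suc δ) f f≥0 = QP.+-mono-≤ (Σ<-nonNeg δ f f≥0) (f≥0 δ)

-- The invariant carries twice
-- the next term, which dominates the whole remaining tail.
geometric-tail : ∀ f → (∀ j → 0ℚ ≤ f j) → (∀ j → f (suc j) + f (suc j) ≤ f j) →
                 ∀ δ → Σ< δ f ≤ f 0 + f 0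
geometric-tail f f≥0 halves δ = QP.≤-trans (x≤x+y (Σ< δ f) (f δ + f δ) (QP.+-mono-≤ (f≥0 δ) (f≥0 δ))) (invariant δ)
  where
  x≤x+y : ∀ x y → 0ℚ ≤ y → x ≤ x + y
  x≤x+y x y y≥0 = subst (_≤ x + y) (QP.+-identityʳ x) (QP.+-monoʳ-≤ x y≥0)
  invariant : ∀ δ → Σ< δ f + (f δ + f δ) ≤ f 0 + f 0
  invariant zero = QP.≤-reflexive (QP.+-identityˡ (f 0 + f 0))
  invariant (suc δ) = QP.≤-trans step (invariant δ)
    where
    open QP.≤-Reasoning
    step : Σ< δ f + f δ + (f (suc δ) + f (suc δ)) ≤ Σ< δ f + (f δ + f δ)
    step = begin
      Σ< δ f + f δ + (f (suc δ) + f (suc δ))  ≤⟨ QP.+-monoʳ-≤ (Σ< δ f + f δ) (halves δ) ⟩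
      Σ< δ f + f δ + f δ                      ≡⟨ QP.+-assoc (Σ< δ f) (f δ) (f δ) ⟩
      Σ< δ f + (f δ + f δ) ∎

cfTail : (ℕ → ℚ) → (ℕ → ℚ) → ℕ → ℕ → ℚ → ℚ
cfTail a b zero s t = t
cfTail a b (suc r) s t = a s ⊘ (b s + cfTail a b r (suc s) t)

cfFrom≡cfTail : ∀ a b r s → cfFrom a b r s ≡ cfTail a b r s 0ℚ
cfFrom≡cfTail a b zero s = refl
cfFrom≡cfTail a b (suc r) s = cong (λ w → a s ⊘ (b s + w)) (cfFrom≡cfTail a b r (suc s))

cfTail-suc : ∀ a b r s t → cfTail a b (suc r) s t ≡ cfTail a b r s (a (s ℕ.+ r) ⊘ (b (s ℕ.+ r) + t))
cfTail-suc a b zero s t rewrite ℕP.+-identityʳ s = refl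
cfTail-suc a b (suc r) s t =
  cong (λ w → a s ⊘ (b s + w))
    (trans (cfTail-suc a b r (suc s) t)
      (cong (λ i → cfTail a b r (suc s) (a i ⊘ (b i + t))) (sym (ℕP.+-suc s r))))

-- The term before index k, with a prescribed value at index -1.
previous : ℚ → (ℕ → ℚ) → ℕ → ℚ
previous x₋₁ X zero = x₋₁
previous x₋₁ X (suc k) = X k

-- The three-term recurrence X_{k+1} = b_{k+1} X_k + a_{k+1} X_{k-1} of the
-- numerators and denominators of the convergents of K(a_m / b_m).
Recurrence : (ℕ → ℚ) → (ℕ → ℚ) → ℚ → (ℕ → ℚ) → Set
Recurrence a b x₋₁ X = ∀ k → X (suc k) ≡ b (suc k) * X k + a (suc k) * previous x₋₁ X k

-- Fundamental theorem of convergents: if P, Q solve the recurrence with the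
-- initial values (P₋₁, P₀) = (1, 0) and (Q₋₁, Q₀) = (0, 1), then every
-- convergent is P_k / Q_k — proved with an arbitrary tail t, taken from a set
-- of admissible tails that keeps all the intermediate denominators nonzero.
module Convergents
  (a b : ℕ → ℚ) (Admissible : ℚ → Set)
  (admissible-denominator : ∀ s t → Admissible t → b s + t ≢ 0ℚ)
  (admissible-step : ∀ s t → Admissible t → Admissible (a s ⊘ (b s + t)))
  (P Q : ℕ → ℚ) (P₀ : P 0 ≡ 0ℚ) (Q₀ : Q 0 ≡ 1ℚ)
  (recP : Recurrence a b 1ℚ P) (recQ : Recurrence a b 0ℚ Q)
  where

  -- With tail t the k-th convergent is (P_k + t P_{k-1}) / (Q_k + t Q_{k-1});
  -- the induction absorbs the last level into the tail (cfTail-suc).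
  cfTail-convergent : ∀ k t → Admissible t →
    cfTail a b k 1 t * (Q k + t * previous 0ℚ Q k) ≡ P k + t * previous 1ℚ P k
  cfTail-convergent zero t _ rewrite P₀ | Q₀ =
    QS.solve 1 (λ t → t QS.:* (QS.con 1ℚ QS.:+ t QS.:* QS.con 0ℚ)
                 QS.:= QS.con 0ℚ QS.:+ t QS.:* QS.con 1ℚ) refl t
  cfTail-convergent (suc k) t adm = begin
      cfTail a b (suc k) 1 t * (Q (suc k) + t * Q k)
        ≡⟨ cong₂ (λ x y → x * (y + t * Q k)) (cfTail-suc a b k 1 t) (recQ k) ⟩
      X * ((B * Q k + A * Q′) + t * Q k)
        ≡⟨ cong (λ w → X * ((B * Q k + w * Q′) + t * Q k)) (sym u-spec) ⟩
      X * ((B * Q k + (u * (B + t)) * Q′) + t * Q k)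
        ≡⟨ QS.solve 6 (λ X B t u Q Q′ →
             X QS.:* ((B QS.:* Q QS.:+ (u QS.:* (B QS.:+ t)) QS.:* Q′) QS.:+ t QS.:* Q)
             QS.:= (B QS.:+ t) QS.:* (X QS.:* (Q QS.:+ u QS.:* Q′))) refl X B t u (Q k) Q′ ⟩
      (B + t) * (X * (Q k + u * Q′))
        ≡⟨ cong ((B + t) *_) (cfTail-convergent k u (admissible-step (suc k) t adm)) ⟩
      (B + t) * (P k + u * P′)
        ≡⟨ QS.solve 5 (λ B t u P P′ →
             (B QS.:+ t) QS.:* (P QS.:+ u QS.:* P′)
             QS.:= (B QS.:* P QS.:+ (u QS.:* (B QS.:+ t)) QS.:* P′) QS.:+ t QS.:* P) refl B t u (P k) P′ ⟩
      (B * P k + (u * (B + t)) * P′) + t * P k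
        ≡⟨ cong (λ w → (B * P k + w * P′) + t * P k) u-spec ⟩
      (B * P k + A * P′) + t * P k
        ≡⟨ cong (_+ t * P k) (sym (recP k)) ⟩
      P (suc k) + t * P k ∎
    where
    open ≡-Reasoning
    A = a (suc k)
    B = b (suc k)
    u = A ⊘ (B + t)
    X = cfTail a b k 1 u
    Q′ = previous 0ℚ Q k
    P′ = previous 1ℚ P k
    u-spec : u * (B + t) ≡ A
    u-spec = ⊘-inverse A (B + t) (admissible-denominator (suc k) t adm)

  K-convergent : Admissible 0ℚ → ∀ k → K a b k * Q k ≡ P k
  K-convergent adm₀ k = begin
      K a b k * Q k                                 ≡⟨ cong (_* Q k) (cfFrom≡cfTail a b k 1) ⟩
      X * Q k                                       ≡⟨ QS.solve 3 (λ X Q Q′ → X QS.:* Q QS.:= X QS.:* (Q QS.:+ QS.con 0ℚ QS.:* Q′)) refl X (Q k) (previous 0ℚ Q k) ⟩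
      X * (Q k + 0ℚ * previous 0ℚ Q k)              ≡⟨ cfTail-convergent k 0ℚ adm₀ ⟩
      P k + 0ℚ * previous 1ℚ P k                    ≡⟨ QS.solve 2 (λ P P′ → P QS.:+ QS.con 0ℚ QS.:* P′ QS.:= P) refl (P k) (previous 1ℚ P k) ⟩
      P k ∎
    where
    open ≡-Reasoning
    X = cfTail a b k 1 0ℚ

-- In the inductive step the
-- recurrence of Q removes the old partial sum, and the hypothesis on τ
-- cancels the two new terms.
series-numerators : ∀ (a b Q τ : ℕ → ℚ) → Recurrence a b 0ℚ Q →
  τ 1 * Q 1 ≡ - a 1 →
  (∀ j → τ (suc (suc j)) * Q (suc (suc j)) ≡ - a (suc (suc j)) * (τ (suc j) * Q j)) →
  Recurrence a b 1ℚ (λ k → - (Σ< k (λ j → τ (suc j)) * Q k))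
series-numerators a b Q τ recQ base step zero = begin
    - ((0ℚ + τ 1) * Q 1)                           ≡⟨ cong -_ (cong (_* Q 1) (QP.+-identityˡ (τ 1))) ⟩
    - (τ 1 * Q 1)                                  ≡⟨ cong -_ base ⟩
    - (- a 1)                                      ≡⟨ QS.solve 3 (λ A B Q₀ → QS.:- (QS.:- A) QS.:= B QS.:* (QS.:- (QS.con 0ℚ QS.:* Q₀)) QS.:+ A QS.:* QS.con 1ℚ) refl (a 1) (b 1) (Q 0) ⟩
    b 1 * - (0ℚ * Q 0) + a 1 * 1ℚ ∎
  where open ≡-Reasoning
series-numerators a b Q τ recQ base step (suc j) = begin
    - ((D + t₁ + t₂) * Q₂)
      ≡⟨ QS.solve 4 (λ D t₁ t₂ Q₂ → QS.:- ((D QS.:+ t₁ QS.:+ t₂) QS.:* Q₂) QS.:= QS.:- ((D QS.:+ t₁) QS.:* Q₂) QS.:+ QS.:- (t₂ QS.:* Q₂)) refl D t₁ t₂ Q₂ ⟩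
    - ((D + t₁) * Q₂) + - (t₂ * Q₂)
      ≡⟨ cong₂ (λ x y → - ((D + t₁) * x) + - y) (recQ (suc j)) (step j) ⟩
    - ((D + t₁) * (B * Q₁ + A * Q₀)) + - (- A * (t₁ * Q₀))
      ≡⟨ QS.solve 6 (λ D t₁ B Q₁ A Q₀ →
            QS.:- ((D QS.:+ t₁) QS.:* (B QS.:* Q₁ QS.:+ A QS.:* Q₀)) QS.:+ QS.:- (QS.:- A QS.:* (t₁ QS.:* Q₀))
            QS.:= B QS.:* (QS.:- ((D QS.:+ t₁) QS.:* Q₁)) QS.:+ A QS.:* (QS.:- (D QS.:* Q₀))) refl D t₁ B Q₁ A Q₀ ⟩
    B * - ((D + t₁) * Q₁) + A * - (D * Q₀) ∎
  where
  open ≡-Reasoning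
  D = Σ< j (λ i → τ (suc i))
  t₁ = τ (suc j)
  t₂ = τ (suc (suc j))
  Q₀ = Q j
  Q₁ = Q (suc j)
  Q₂ = Q (suc (suc j))
  A = a (suc (suc j))
  B = b (suc (suc j))

module EulerFraction (m : ℕ) where

  n : ℕ
  n = suc m

  a b : ℕ → ℚ
  a = cfNum n
  b = cfDen n

  -- Tails in [-n, 0] are admissible: they keep every denominator
  -- b_s + t ≥ s + n + 1 positive and are reproduced by a_s / (b_s + t).
  Admissible : ℚ → Set
  Admissible t = - ℕ→ℚ n ≤ t × t ≤ 0ℚ

  denominator-lower : ∀ s t → - ℕ→ℚ n ≤ t → ℕ→ℚ (suc (s ℕ.+ n)) ≤ b s + t
  denominator-lower s t -n≤t = begin
      X                  ≡⟨ sym (QP.+-identityʳ X) ⟩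
      X + 0ℚ             ≤⟨ QP.+-monoʳ-≤ X (subst (_≤ ℕ→ℚ n + t) (QP.+-inverseʳ (ℕ→ℚ n)) (QP.+-monoʳ-≤ (ℕ→ℚ n) -n≤t)) ⟩
      X + (ℕ→ℚ n + t)    ≡⟨ sym (QP.+-assoc X (ℕ→ℚ n) t) ⟩
      (X + ℕ→ℚ n) + t    ≡⟨ cong (_+ t) (trans (sym (ℕ→ℚ-+ (suc (s ℕ.+ n)) n)) (cong ℕ→ℚ (b-value s n))) ⟩
      b s + t ∎
    where
    open QP.≤-Reasoning
    X = ℕ→ℚ (suc (s ℕ.+ n))
    b-value : ∀ s n → suc (s ℕ.+ n) ℕ.+ n ≡ s ℕ.+ 2 ℕ.* n ℕ.+ 1
    b-value = ℕRing.solve-∀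

  denominator-positive : ∀ s t → Admissible t → Q.Positive (b s + t)
  denominator-positive s t (lo , _) =
    Q.positive (QP.<-≤-trans (QP.positive⁻¹ _ {{ℕ→ℚ-positive (suc (s ℕ.+ n)) _}}) (denominator-lower s t lo))

  admissible-denominator : ∀ s t → Admissible t → b s + t ≢ 0ℚ
  admissible-denominator s t adm eq =
    QP.<⇒≢ (QP.positive⁻¹ _ {{denominator-positive s t adm}}) (sym eq)

  -- Since 0 ≤ -a_s = n(s+n-1) ≤ n(s+n+1) ≤ n(b_s + t), the quotient
  -- a_s / (b_s + t) lies again in [-n, 0].
  admissible-step : ∀ s t → Admissible t → Admissible (a s ⊘ (b s + t))
  admissible-step s t adm@(lo , _) = lower , upper
    where
    open QP.≤-Reasoning
    den = b s + t
    instance _ = denominator-positive s t adm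
    u-spec : (a s ⊘ den) * den ≡ a s
    u-spec = ⊘-inverse (a s) den (admissible-denominator s t adm)
    upper : a s ⊘ den ≤ 0ℚ
    upper = QP.*-cancelʳ-≤-pos den (begin
      (a s ⊘ den) * den   ≡⟨ u-spec ⟩
      a s                 ≤⟨ QP.neg-antimono-≤ (ℕ→ℚ-nonNeg (n ℕ.* (s ℕ.+ n ℕ.∸ 1))) ⟩
      0ℚ                  ≡⟨ sym (QP.*-zeroˡ den) ⟩
      0ℚ * den ∎)
    numerator-bound : ℕ→ℚ (n ℕ.* (s ℕ.+ n ℕ.∸ 1)) ≤ ℕ→ℚ n * den
    numerator-bound = begin
      ℕ→ℚ (n ℕ.* (s ℕ.+ n ℕ.∸ 1))   ≤⟨ ℕ→ℚ-mono-≤ (ℕP.*-monoʳ-≤ n (ℕP.≤-trans (ℕP.m∸n≤m (s ℕ.+ n) 1) (ℕP.n≤1+n (s ℕ.+ n)))) ⟩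
      ℕ→ℚ (n ℕ.* suc (s ℕ.+ n))     ≡⟨ ℕ→ℚ-* n (suc (s ℕ.+ n)) ⟩
      ℕ→ℚ n * ℕ→ℚ (suc (s ℕ.+ n))   ≤⟨ QP.*-monoˡ-≤-nonNeg (ℕ→ℚ n) {{Q.nonNegative (ℕ→ℚ-nonNeg n)}} (denominator-lower s t lo) ⟩
      ℕ→ℚ n * den ∎
    lower : - ℕ→ℚ n ≤ a s ⊘ den
    lower = QP.*-cancelʳ-≤-pos den (begin
      (- ℕ→ℚ n) * den     ≡⟨ sym (QP.neg-distribˡ-* (ℕ→ℚ n) den) ⟩
      - (ℕ→ℚ n * den)     ≤⟨ QP.neg-antimono-≤ numerator-bound ⟩
      a s                 ≡⟨ sym u-spec ⟩
      (a s ⊘ den) * den ∎)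

  rising : ℕ → ℕ
  rising k = poch (suc n) k

  rising-nonZero : ∀ k → NonZero (rising k)
  rising-nonZero = poch-nonZero n

  Qden : ℕ → ℕ
  Qden k = suc k ℕ.* rising k

  Qden-nonZero : ∀ k → NonZero (Qden k)
  Qden-nonZero k = ℕP.m*n≢0 (suc k) (rising k) {{_}} {{rising-nonZero k}}

  Qₖ : ℕ → ℚ
  Qₖ k = ℕ→ℚ (Qden k)

  τden : ℕ → ℕ
  τden j = j ℕ.* suc j ℕ.* rising j

  τden-nonZero : ∀ j → NonZero (τden (suc j))
  τden-nonZero j = ℕP.m*n≢0 (suc j ℕ.* suc (suc j)) (rising (suc j)) {{_}} {{rising-nonZero (suc j)}}

  τ : ℕ → ℚ
  τ j = (n ℕ.^ suc j) /ℕ τden j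

  D : ℕ → ℚ
  D k = Σ< k (λ j → τ (suc j))

  Pₖ : ℕ → ℚ
  Pₖ k = - (D k * Qₖ k)

  Q-recurrence : Recurrence a b 0ℚ Qₖ
  Q-recurrence zero = ℕ→ℚ-rearrange (Qden 1) (Qden 0) 0 (n ℕ.* n) (1 ℕ.+ 2 ℕ.* n ℕ.+ 1) (identity n)
    where
    identity : ∀ n → 2 ℕ.* (1 ℕ.* (suc n ℕ.+ 0)) ℕ.+ n ℕ.* n ℕ.* 0 ≡ (1 ℕ.+ 2 ℕ.* n ℕ.+ 1) ℕ.* (1 ℕ.* 1)
    identity = ℕRing.solve-∀
  Q-recurrence (suc j) =
    ℕ→ℚ-rearrange (Qden (suc (suc j))) (Qden (suc j)) (Qden j) (n ℕ.* (suc j ℕ.+ n))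
      (suc (suc j) ℕ.+ 2 ℕ.* n ℕ.+ 1) (identity n j (rising j))
    where
    identity : ∀ n j R → (3 ℕ.+ j) ℕ.* (R ℕ.* (suc n ℕ.+ j) ℕ.* (suc n ℕ.+ suc j))
                         ℕ.+ n ℕ.* (suc j ℕ.+ n) ℕ.* ((1 ℕ.+ j) ℕ.* R)
                       ≡ (2 ℕ.+ j ℕ.+ 2 ℕ.* n ℕ.+ 1) ℕ.* ((2 ℕ.+ j) ℕ.* (R ℕ.* (suc n ℕ.+ j)))
    identity = ℕRing.solve-∀

  -- The hypotheses of Euler's transformation: τ₁Q₁ = n² = -a₁ and
  -- τ_{j+2}Q_{j+2} = n^{j+3}/(j+2) = n(j+1+n) · τ_{j+1}Q_j.
  τ-base : τ 1 * Qₖ 1 ≡ - a 1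
  τ-base = trans (/ℕ-clear (n ℕ.^ 2) (τden 1) (Qden 1) (n ℕ.* n) (τden-nonZero 0) (identity n))
                 (sym (neg-involutive (ℕ→ℚ (n ℕ.* n))))
    where
    identity : ∀ n → n ℕ.* (n ℕ.* 1) ℕ.* (2 ℕ.* (1 ℕ.* (suc n ℕ.+ 0)))
                   ≡ n ℕ.* n ℕ.* (1 ℕ.* 2 ℕ.* (1 ℕ.* (suc n ℕ.+ 0)))
    identity = ℕRing.solve-∀

  τ-step : ∀ j → τ (suc (suc j)) * Qₖ (suc (suc j)) ≡ - a (suc (suc j)) * (τ (suc j) * Qₖ j)
  τ-step j = begin
      τ (suc (suc j)) * Qₖ (suc (suc j))   ≡⟨ /ℕ-scale (n ℕ.^ 3+j) (τden (suc (suc j))) (Qden (suc (suc j))) (τden-nonZero (suc j)) ⟩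
      (n ℕ.^ 3+j ℕ.* Qden (suc (suc j))) /ℕ τden (suc (suc j))
        ≡⟨ /ℕ-cross (n ℕ.^ 3+j ℕ.* Qden (suc (suc j))) (τden (suc (suc j))) (n ℕ.^ 2+j ℕ.* Qden j ℕ.* A) (τden (suc j)) (τden-nonZero (suc j)) (τden-nonZero j) (identity n j (rising j) (n ℕ.^ suc (suc j))) ⟩
      (n ℕ.^ 2+j ℕ.* Qden j ℕ.* A) /ℕ τden (suc j)
        ≡⟨ sym (/ℕ-scale (n ℕ.^ 2+j ℕ.* Qden j) (τden (suc j)) A (τden-nonZero j)) ⟩
      ((n ℕ.^ 2+j ℕ.* Qden j) /ℕ τden (suc j)) * ℕ→ℚ A
        ≡⟨ cong₂ _*_ (sym (/ℕ-scale (n ℕ.^ 2+j) (τden (suc j)) (Qden j) (τden-nonZero j))) (sym (neg-involutive (ℕ→ℚ A))) ⟩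
      (τ (suc j) * Qₖ j) * - a (suc (suc j))
        ≡⟨ QP.*-comm (τ (suc j) * Qₖ j) (- a (suc (suc j))) ⟩
      - a (suc (suc j)) * (τ (suc j) * Qₖ j) ∎
    where
    open ≡-Reasoning
    2+j = suc (suc j)
    3+j = suc (suc (suc j))
    A = n ℕ.* (suc j ℕ.+ n)
    identity : ∀ n j R X →
      n ℕ.* X ℕ.* ((3 ℕ.+ j) ℕ.* (R ℕ.* (suc n ℕ.+ j) ℕ.* (suc n ℕ.+ suc j)))
        ℕ.* ((1 ℕ.+ j) ℕ.* (2 ℕ.+ j) ℕ.* (R ℕ.* (suc n ℕ.+ j)))
      ≡ X ℕ.* ((1 ℕ.+ j) ℕ.* R) ℕ.* (n ℕ.* (suc j ℕ.+ n))
        ℕ.* ((2 ℕ.+ j) ℕ.* (3 ℕ.+ j) ℕ.* (R ℕ.* (suc n ℕ.+ j) ℕ.* (suc n ℕ.+ suc j)))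
    identity = ℕRing.solve-∀

  K-value : ∀ k → K a b k ≡ - D k
  K-value k = *-cancelʳ-≢0 _ _ (Qₖ k) (ℕ→ℚ-≢0 (Qden k) (Qden-nonZero k))
    (trans (K-convergent (QP.neg-antimono-≤ (ℕ→ℚ-nonNeg n) , QP.≤-refl) k)
           (QP.neg-distribˡ-* (D k) (Qₖ k)))
    where
    open Convergents a b Admissible admissible-denominator admissible-step Pₖ Qₖ refl refl
           (series-numerators a b Qₖ τ Q-recurrence τ-base τ-step) Q-recurrence

  c : ℚ
  c = (n ℕ.^ m) /ℕ (m !)

  h : ℕ → ℚ
  h i = (n ℕ.^ i) /ℕ rising i

  taylor-term : ∀ i → (n ℕ.^ (n ℕ.+ i)) /ℕ ((n ℕ.+ i) !) ≡ c * h i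
  taylor-term i = sym (trans (/ℕ-* (n ℕ.^ m) (m !) (n ℕ.^ i) (rising i) (m !≢0) (rising-nonZero i))
    (/ℕ-cross (n ℕ.^ m ℕ.* n ℕ.^ i) (m ! ℕ.* rising i) (n ℕ.^ (n ℕ.+ i)) ((n ℕ.+ i) !) (ℕP.m*n≢0 (m !) (rising i) {{m !≢0}} {{rising-nonZero i}}) ((n ℕ.+ i) !≢0) cross))
    where
    open ≡-Reasoning
    identity : ∀ n X Y F R → X ℕ.* Y ℕ.* (n ℕ.* F ℕ.* R) ≡ n ℕ.* (X ℕ.* Y) ℕ.* (F ℕ.* R)
    identity = ℕRing.solve-∀
    cross : n ℕ.^ m ℕ.* n ℕ.^ i ℕ.* (n ℕ.+ i) ! ≡ n ℕ.^ (n ℕ.+ i) ℕ.* (m ! ℕ.* rising i)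
    cross = begin
      n ℕ.^ m ℕ.* n ℕ.^ i ℕ.* (n ℕ.+ i) !            ≡⟨ cong (n ℕ.^ m ℕ.* n ℕ.^ i ℕ.*_) (factorial-split n i) ⟩
      n ℕ.^ m ℕ.* n ℕ.^ i ℕ.* (n ℕ.* m ! ℕ.* rising i) ≡⟨ identity n (n ℕ.^ m) (n ℕ.^ i) (m !) (rising i) ⟩
      n ℕ.* (n ℕ.^ m ℕ.* n ℕ.^ i) ℕ.* (m ! ℕ.* rising i) ≡⟨ cong (λ w → n ℕ.* w ℕ.* (m ! ℕ.* rising i)) (sym (ℕP.^-distribˡ-+-* n m i)) ⟩
      n ℕ.^ (n ℕ.+ i) ℕ.* (m ! ℕ.* rising i) ∎

  expPartial-split : ∀ i → expPartial n (n ℕ.+ i) ≡ expPartial n n + c * Σ< i h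
  expPartial-split zero = trans (cong (expPartial n) (ℕP.+-identityʳ n))
    (QS.solve 2 (λ E c → E QS.:= E QS.:+ c QS.:* QS.con 0ℚ) refl (expPartial n n) c)
  expPartial-split (suc i) = begin
      expPartial n (n ℕ.+ suc i)                         ≡⟨ cong (expPartial n) (ℕP.+-suc n i) ⟩
      expPartial n (n ℕ.+ i) + g (n ℕ.+ i)               ≡⟨ cong₂ _+_ (expPartial-split i) (taylor-term i) ⟩
      (expPartial n n + c * Σ< i h) + c * h i           ≡⟨ QS.solve 4 (λ E c S t → (E QS.:+ c QS.:* S) QS.:+ c QS.:* t QS.:= E QS.:+ c QS.:* (S QS.:+ t)) refl (expPartial n n) c (Σ< i h) (h i) ⟩
      expPartial n n + c * (Σ< i h + h i) ∎
    where
    open ≡-Reasoning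
    g : ℕ → ℚ
    g j = (n ℕ.^ j) /ℕ (j !)

  e : ℕ → ℚ
  e M = (n ℕ.^ suc M) /ℕ Qden M

  remainder-step : ∀ M → h (suc M) + τ (suc M) + e (suc M) ≡ e M
  remainder-step M =
    trans (cong (_+ e (suc M)) (/ℕ-+ X d₁ (n ℕ.* X) d₂ nz₁ nz₂))
      (trans (/ℕ-+ x₁₂ (d₁ ℕ.* d₂) (n ℕ.* X) d₃ (ℕP.m*n≢0 d₁ d₂ {{nz₁}} {{nz₂}}) nz₃)
        (/ℕ-cross (x₁₂ ℕ.* d₃ ℕ.+ n ℕ.* X ℕ.* (d₁ ℕ.* d₂)) (d₁ ℕ.* d₂ ℕ.* d₃) X (Qden M) (ℕP.m*n≢0 (d₁ ℕ.* d₂) d₃ {{ℕP.m*n≢0 d₁ d₂ {{nz₁}} {{nz₂}}}} {{nz₃}}) (Qden-nonZero M)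
          (identity n M X (rising M))))
    where
    X = n ℕ.^ suc M
    d₁ = rising (suc M)
    d₂ = τden (suc M)
    d₃ = Qden (suc M)
    nz₁ = rising-nonZero (suc M)
    nz₂ = τden-nonZero M
    nz₃ = Qden-nonZero (suc M)
    x₁₂ = X ℕ.* d₂ ℕ.+ n ℕ.* X ℕ.* d₁
    identity : ∀ n M X R →
      let d₁ = R ℕ.* (suc n ℕ.+ M)
          d₂ = suc M ℕ.* suc (suc M) ℕ.* (R ℕ.* (suc n ℕ.+ M))
          d₃ = suc (suc M) ℕ.* (R ℕ.* (suc n ℕ.+ M))
      in ((X ℕ.* d₂ ℕ.+ n ℕ.* X ℕ.* d₁) ℕ.* d₃ ℕ.+ n ℕ.* X ℕ.* (d₁ ℕ.* d₂)) ℕ.* (suc M ℕ.* R)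
         ≡ X ℕ.* (d₁ ℕ.* d₂ ℕ.* d₃)
    identity = ℕRing.solve-∀

  telescoping : ∀ M → Σ< (suc M) h + D M + e M ≡ 1ℚ + ℕ→ℚ n
  telescoping zero = begin
      0ℚ + h 0 + 0ℚ + e 0     ≡⟨ cong (λ w → 0ℚ + 1ℚ + 0ℚ + w) e₀ ⟩
      0ℚ + 1ℚ + 0ℚ + ℕ→ℚ n    ≡⟨ QS.solve 1 (λ x → QS.con 0ℚ QS.:+ QS.con 1ℚ QS.:+ QS.con 0ℚ QS.:+ x QS.:= QS.con 1ℚ QS.:+ x) refl (ℕ→ℚ n) ⟩
      1ℚ + ℕ→ℚ n ∎
    where
    open ≡-Reasoning
    e₀ : e 0 ≡ ℕ→ℚ n
    e₀ = sym (/ℕ-unique (n ℕ.* 1) 1 _ (trans (QP.*-identityʳ (ℕ→ℚ n)) (cong ℕ→ℚ (sym (ℕP.*-identityʳ n)))))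
  telescoping (suc M) = begin
      (S + h (suc M)) + (D M + τ (suc M)) + e (suc M)
        ≡⟨ QS.solve 5 (λ S d x y z → (S QS.:+ x) QS.:+ (d QS.:+ y) QS.:+ z QS.:= S QS.:+ d QS.:+ (x QS.:+ y QS.:+ z)) refl S (D M) (h (suc M)) (τ (suc M)) (e (suc M)) ⟩
      S + D M + (h (suc M) + τ (suc M) + e (suc M))
        ≡⟨ cong (λ w → S + D M + w) (remainder-step M) ⟩
      S + D M + e M
        ≡⟨ telescoping M ⟩
      1ℚ + ℕ→ℚ n ∎
    where
    open ≡-Reasoning
    S = Σ< (suc M) h

  τ-nonNeg : ∀ j → 0ℚ ≤ τ (suc j)
  τ-nonNeg j = /ℕ-nonNeg (n ℕ.^ suc (suc j)) (τden (suc j)) (τden-nonZero j)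

  τ-halves : ∀ i → n ℕ.≤ suc i → τ (suc (suc i)) + τ (suc (suc i)) ≤ τ (suc i)
  τ-halves i n≤j = subst (_≤ τ j) (sym (/ℕ-double x (τden (suc j)) (τden-nonZero j)))
      (/ℕ-mono-≤ (x ℕ.+ x) (τden (suc j)) Y (τden j) (τden-nonZero j) (τden-nonZero i) cross)
    where
    open ℕP.≤-Reasoning
    j = suc i
    Y = n ℕ.^ suc j
    x = n ℕ.^ suc (suc j)
    Z = Y ℕ.* suc j ℕ.* rising j
    lhs : ∀ N J Y R → (N ℕ.* Y ℕ.+ N ℕ.* Y) ℕ.* (J ℕ.* suc J ℕ.* R) ≡ 2 ℕ.* N ℕ.* J ℕ.* (Y ℕ.* suc J ℕ.* R)
    lhs = ℕRing.solve-∀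
    rhs : ∀ N J Y R → (2 ℕ.+ J) ℕ.* (suc N ℕ.+ J) ℕ.* (Y ℕ.* suc J ℕ.* R)
                      ≡ Y ℕ.* (suc J ℕ.* suc (suc J) ℕ.* (R ℕ.* (suc N ℕ.+ J)))
    rhs = ℕRing.solve-∀
    cross : (x ℕ.+ x) ℕ.* τden j ℕ.≤ Y ℕ.* τden (suc j)
    cross = begin
      (x ℕ.+ x) ℕ.* τden j                  ≡⟨ lhs n j Y (rising j) ⟩
      2 ℕ.* n ℕ.* j ℕ.* Z                   ≤⟨ ℕP.*-monoˡ-≤ Z (halving-inequality n j n≤j) ⟩
      (2 ℕ.+ j) ℕ.* (suc n ℕ.+ j) ℕ.* Z     ≡⟨ rhs n j Y (rising j) ⟩
      Y ℕ.* τden (suc j) ∎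

  tail-sum : ℕ → ℕ → ℚ
  tail-sum k δ = Σ< δ (λ j → τ (suc (k ℕ.+ j)))

  D-split : ∀ k δ → D (k ℕ.+ δ) ≡ D k + tail-sum k δ
  D-split k δ = Σ<-split k δ (λ j → τ (suc j))

  tail-sum-bound : ∀ k δ → n ℕ.≤ k → tail-sum k δ ≤ τ (suc k) + τ (suc k)
  tail-sum-bound k δ n≤k = subst (λ i → tail-sum k δ ≤ τ (suc i) + τ (suc i)) (ℕP.+-identityʳ k)
    (geometric-tail (λ j → τ (suc (k ℕ.+ j))) (λ j → τ-nonNeg (k ℕ.+ j)) halves δ)
    where
    halves : ∀ j → τ (suc (k ℕ.+ suc j)) + τ (suc (k ℕ.+ suc j)) ≤ τ (suc (k ℕ.+ j))
    halves j = subst (λ i → τ (suc i) + τ (suc i) ≤ τ (suc (k ℕ.+ j))) (sym (ℕP.+-suc k j))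
      (τ-halves (k ℕ.+ j) (ℕP.≤-trans n≤k (ℕP.≤-trans (ℕP.m≤m+n k j) (ℕP.n≤1+n (k ℕ.+ j)))))

  -- 2τ_{k+1}, scaled by c, is a constant multiple of the claimed error bound,
  -- because (n)_{k+2} = n·(n+1)_{k+1}.
  errorConstant : ℚ
  errorConstant = ℕ→ℚ (2 ℕ.* (n ℕ.* n)) * c

  error-term : ∀ k → c * (τ (suc k) + τ (suc k)) ≡ errorConstant * errBound n k
  error-term k = begin
      c * (τ (suc k) + τ (suc k))                  ≡⟨ cong (c *_) (/ℕ-double x (τden (suc k)) (τden-nonZero k)) ⟩
      c * ((x ℕ.+ x) /ℕ τden (suc k))              ≡⟨ cong (c *_) (/ℕ-cross (x ℕ.+ x) (τden (suc k)) (x′ ℕ.* W) errDen (τden-nonZero k) errDen-nonZero cross) ⟩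
      c * ((x′ ℕ.* W) /ℕ errDen)                   ≡⟨ cong (c *_) (sym (/ℕ-scale x′ errDen W errDen-nonZero)) ⟩
      c * (errBound n k * ℕ→ℚ W)                   ≡⟨ QS.solve 3 (λ c E W → c QS.:* (E QS.:* W) QS.:= W QS.:* c QS.:* E) refl c (errBound n k) (ℕ→ℚ W) ⟩
      errorConstant * errBound n k ∎
    where
    open ≡-Reasoning
    x = n ℕ.^ suc (suc k)
    x′ = n ℕ.^ suc k
    W = 2 ℕ.* (n ℕ.* n)
    errDen = suc k ℕ.* suc (suc k) ℕ.* poch n (suc (suc k))
    errDen-nonZero : NonZero errDen
    errDen-nonZero = subst (λ w → NonZero (suc k ℕ.* suc (suc k) ℕ.* w)) (sym (poch-shift n (suc k)))
      (ℕP.m*n≢0 (suc k ℕ.* suc (suc k)) (n ℕ.* rising (suc k)) {{_}} {{ℕP.m*n≢0 n (rising (suc k)) {{_}} {{rising-nonZero (suc k)}}}})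
    identity : ∀ n X A B R → (n ℕ.* X ℕ.+ n ℕ.* X) ℕ.* (A ℕ.* B ℕ.* (n ℕ.* R))
                           ≡ X ℕ.* (2 ℕ.* (n ℕ.* n)) ℕ.* (A ℕ.* B ℕ.* R)
    identity = ℕRing.solve-∀
    cross : (x ℕ.+ x) ℕ.* errDen ≡ x′ ℕ.* W ℕ.* τden (suc k)
    cross = trans (cong (λ w → (x ℕ.+ x) ℕ.* (suc k ℕ.* suc (suc k) ℕ.* w)) (poch-shift n (suc k)))
                  (identity n x′ (suc k) (suc (suc k)) (rising (suc k)))

  -- c·e_M ≤ (p+1)/(d+1) as soon as nⁿ(d+1) ≤ M + 1, since nᴹ ≤ (n+1)_M.
  remainder-small : ∀ M d p → n ℕ.^ n ℕ.* suc d ℕ.≤ suc M → c * e M ≤ suc p /ℕ suc d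
  remainder-small M d p large =
    subst (_≤ suc p /ℕ suc d) (sym (/ℕ-* (n ℕ.^ m) (m !) (n ℕ.^ suc M) (Qden M) (m !≢0) (Qden-nonZero M)))
      (/ℕ-mono-≤ X Y (suc p) (suc d) (ℕP.m*n≢0 (m !) (Qden M) {{m !≢0}} {{Qden-nonZero M}}) _ cross)
    where
    open ℕP.≤-Reasoning
    X = n ℕ.^ m ℕ.* n ℕ.^ suc M
    Y = m ! ℕ.* Qden M
    identity : ∀ A n Y S → A ℕ.* (n ℕ.* Y) ℕ.* S ≡ n ℕ.* A ℕ.* S ℕ.* Y
    identity = ℕRing.solve-∀
    cross : X ℕ.* suc d ℕ.≤ suc p ℕ.* Y
    cross = begin
      X ℕ.* suc d                              ≡⟨ identity (n ℕ.^ m) n (n ℕ.^ M) (suc d) ⟩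
      n ℕ.^ n ℕ.* suc d ℕ.* n ℕ.^ M            ≤⟨ ℕP.*-mono-≤ large (power≤poch n M) ⟩
      Qden M                                   ≤⟨ ℕP.m≤n*m (Qden M) (m !) {{m !≢0}} ⟩
      Y                                        ≤⟨ ℕP.m≤n*m Y (suc p) ⟩
      suc p ℕ.* Y ∎

  partial-sum-minus-convergent : ∀ k δ →
    expPartial n (n ℕ.+ suc (k ℕ.+ δ)) - convergent n k ≡ - (c * (tail-sum k δ + e (k ℕ.+ δ)))
  partial-sum-minus-convergent k δ = begin
      expPartial n (n ℕ.+ suc M) - convergent n k
        ≡⟨ cong₂ _-_ (expPartial-split (suc M)) (cong (λ w → E + c * w) (cong₂ _+_ (sym (telescoping M)) (K-value k))) ⟩
      (E + c * S) - (E + c * (S + D M + e M + - D k))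
        ≡⟨ cong (λ w → (E + c * S) - (E + c * (S + w + e M + - D k))) (D-split k δ) ⟩
      (E + c * S) - (E + c * (S + (D k + G) + e M + - D k))
        ≡⟨ QS.solve 6 (λ E c S Dk G eM →
             (E QS.:+ c QS.:* S) QS.:- (E QS.:+ c QS.:* (S QS.:+ (Dk QS.:+ G) QS.:+ eM QS.:+ QS.:- Dk))
             QS.:= QS.:- (c QS.:* (G QS.:+ eM))) refl E c S (D k) G (e M) ⟩
      - (c * (G + e M)) ∎
    where
    open ≡-Reasoning
    M = k ℕ.+ δ
    E = expPartial n n
    S = Σ< (suc M) h
    G = tail-sum k δ

  error-estimate : ∀ k δ d p → n ℕ.≤ k → n ℕ.^ n ℕ.* suc d ℕ.≤ suc (k ℕ.+ δ) →
    ∣ expPartial n (n ℕ.+ suc (k ℕ.+ δ)) - convergent n k ∣ ≤ errorConstant * errBound n k + suc p /ℕ suc d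
  error-estimate k δ d p n≤k large = begin
      ∣ expPartial n (n ℕ.+ suc M) - convergent n k ∣   ≡⟨ cong ∣_∣ (partial-sum-minus-convergent k δ) ⟩
      ∣ - (c * (G + e M)) ∣                              ≡⟨ QP.∣-p∣≡∣p∣ (c * (G + e M)) ⟩
      ∣ c * (G + e M) ∣                                  ≡⟨ QP.0≤p⇒∣p∣≡p (QP.nonNegative⁻¹ _ {{QP.nonNeg*nonNeg⇒nonNeg c {{c≥0}} (G + e M) {{G+e≥0}}}}) ⟩
      c * (G + e M)                                      ≡⟨ QP.*-distribˡ-+ c G (e M) ⟩
      c * G + c * e M                                    ≤⟨ QP.+-mono-≤ cG-bound (remainder-small M d p large) ⟩
      errorConstant * errBound n k + suc p /ℕ suc d ∎
    where
    open QP.≤-Reasoning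
    M = k ℕ.+ δ
    G = tail-sum k δ
    c≥0 : Q.NonNegative c
    c≥0 = Q.nonNegative (/ℕ-nonNeg (n ℕ.^ m) (m !) (m !≢0))
    G+e≥0 : Q.NonNegative (G + e M)
    G+e≥0 = Q.nonNegative (QP.+-mono-≤ (Σ<-nonNeg δ _ (λ j → τ-nonNeg (k ℕ.+ j)))
                                       (/ℕ-nonNeg (n ℕ.^ suc M) (Qden M) (Qden-nonZero M)))
    cG-bound : c * G ≤ errorConstant * errBound n k
    cG-bound = QP.≤-trans (QP.*-monoˡ-≤-nonNeg c {{c≥0}} (tail-sum-bound k δ n≤k)) (QP.≤-reflexive (error-term k))

  eventually-close : ∀ k d p → n ℕ.≤ k → ∀ N → n ℕ.+ suc (k ℕ.+ n ℕ.^ n ℕ.* suc d) ℕ.≤ N →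
    ∣ expPartial n N - convergent n k ∣ ≤ errorConstant * errBound n k + suc p /ℕ suc d
  eventually-close k d p n≤k N N≥ with ℕP.m≤n⇒∃[o]m+o≡n N≥
  ... | o , refl = subst (λ N → ∣ expPartial n N - convergent n k ∣ ≤ errorConstant * errBound n k + suc p /ℕ suc d)
                     (regroup n k (n ℕ.^ n ℕ.* suc d) o)
                     (error-estimate k (n ℕ.^ n ℕ.* suc d ℕ.+ o) d p n≤k large)
    where
    regroup : ∀ n k B o → n ℕ.+ suc (k ℕ.+ (B ℕ.+ o)) ≡ n ℕ.+ suc (k ℕ.+ B) ℕ.+ o
    regroup = ℕRing.solve-∀
    large : n ℕ.^ n ℕ.* suc d ℕ.≤ suc (k ℕ.+ (n ℕ.^ n ℕ.* suc d ℕ.+ o))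
    large = ℕP.≤-trans (ℕP.m≤m+n _ o) (ℕP.≤-trans (ℕP.m≤n+m _ k) (ℕP.n≤1+n _))

-- Corollary 2.5: |eⁿ - C_k| = O(errBound n k), with constant 2n²c valid for
-- all k ≥ n, where eⁿ is approximated by its Taylor partial sums to any ε > 0.
corollary2p5 : (n : ℕ) → n ≥ 1 →
    Σ ℚ λ M → Σ ℕ λ K0 → (k : ℕ) → k ≥ K0 →
      (ε : ℚ) → 0ℚ < ε → Σ ℕ λ N0 → (N : ℕ) → N ≥ N0 →
        ∣ expPartial n N - convergent n k ∣ ≤ M * errBound n k + ε
corollary2p5 zero ()
corollary2p5 (suc m) _ = errorConstant , n , λ k n≤k ε ε>0 →
  let (d , p , ε≡) = positive-fraction ε ε>0 in
  n ℕ.+ suc (k ℕ.+ n ℕ.^ n ℕ.* suc d) , λ N N≥ →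
    subst (λ ε′ → ∣ expPartial n N - convergent n k ∣ ≤ errorConstant * errBound n k + ε′) (sym ε≡)
      (eventually-close k d p n≤k N N≥)
  where open EulerFraction m
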